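{- Let $m$ be a positive integer. If $G$ is a finite group which is not an elementary abelian $2$-group and the matching number of its power graph satisfies $\mu(P(G))=m$, then $|G|<8m+4$. In particular, up to isomorphism there are only finitely many finite groups $G$ with $\mu(P(G))=m$ apart from elementary abelian $2$-groups (which have $\mu(P(G))=1$).
   Context: The power graph $P(G)$ of a finite group $G$ is the simple undirected graph with vertex set $G$ in which distinct $x,y$ are adjacent iff one is a power of the other. $\mu(\Gamma)$ denotes the matching number of a graph $\Gamma$, i.e. the maximum number of pairwise vertex-disjoint edges. -}

module Defs where

open import Data.Nat using (ℕ; zero; suc)
open import Data.Fin using (Fin)
open import Data.Product using (Σ; ∃; _×_; _,_; proj₁; proj₂)
open import Data.Sum using (_⊎_)
open import Data.List using (List; []; _∷_; length; concatMap)
open import Data.List.Relation.Unary.All using (All)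
open import Data.List.Relation.Unary.Unique.Propositional using (Unique)
open import Relation.Binary.PropositionalEquality using (_≡_)
open import Relation.Nullary using (¬_)
open import Algebra.Structures using (IsGroup)

-- A finite group of order n: a group structure (with propositional
-- equality) on the carrier Fin n.  Every finite group is isomorphic
-- to one of this form.
record FiniteGroup : Set where
  field
    order   : ℕ
    _∙_     : Fin order → Fin order → Fin order
    ε       : Fin order
    _⁻¹     : Fin order → Fin order
    isGroup : IsGroup _≡_ _∙_ ε _⁻¹

module _ (G : FiniteGroup) where
  open FiniteGroup G

  pow : Fin order → ℕ → Fin order
  pow x zero    = ε
  pow x (suc k) = x ∙ pow x k

  IsPowerOf : Fin order → Fin order → Set
  IsPowerOf y x = ∃ λ k → y ≡ pow x k

  PowerAdj : Fin order → Fin order → Set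
  PowerAdj x y = ¬ (x ≡ y) × (IsPowerOf y x ⊎ IsPowerOf x y)

  endpoints : List (Fin order × Fin order) → List (Fin order)
  endpoints = concatMap (λ e → proj₁ e ∷ proj₂ e ∷ [])

  IsMatching : List (Fin order × Fin order) → Set
  IsMatching M = All (λ e → PowerAdj (proj₁ e) (proj₂ e)) M × Unique (endpoints M)

  MatchingNumberIs : ℕ → Set
  MatchingNumberIs m =
    (∃ λ M → IsMatching M × length M ≡ m) ×
    (∀ M → IsMatching M → length M Data.Nat.≤ m)

  IsElementaryAbelian2 : Set
  IsElementaryAbelian2 = (∀ x y → (x ∙ y) ≡ (y ∙ x)) × (∀ x → (x ∙ x) ≡ ε)

{-# OPTIONS --safe #-}
module Submission where

-- An element x with x ∙ x ≢ ε differs from x ⁻¹, which is a power of x, so the pairs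
-- {x , x ⁻¹} of such elements form a matching of P(G): there are at most 2μ of them.
-- If more than three quarters of G square to ε, then G is an elementary abelian 2-group:
-- for such an a, the elements z with z ∙ z = (a ∙ z) ∙ (a ∙ z) = ε commute with a and make
-- up more than half of G, so a is central; and every g is a product (g ∙ y) ∙ y of two
-- such elements.  Hence at least a quarter of G does not square to ε, and |G| ≤ 4 · 2μ.

open import Defs
open import Algebra.Bundles using (Group)
open import Algebra.Structures using (IsGroup)
import Algebra.Properties.Group as GroupProperties
open import Data.Fin as Fin using (Fin; zero; suc; toℕ)
open import Data.Fin.Permutation using (Permutation; permutation; _⟨$⟩ʳ_)
open import Data.Fin.Properties using (toℕ-injective; pigeonhole)
open import Data.List using (List; []; _∷_; length; filter; tabulate; map; allFin)
open import Data.List.Properties using (length-map)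
open import Data.List.Relation.Unary.All as All using (All; []; _∷_)
open import Data.List.Relation.Unary.All.Properties using (all-filter)
open import Data.List.Relation.Unary.AllPairs using ([]; _∷_)
open import Data.List.Relation.Unary.Unique.Propositional using (Unique)
import Data.List.Relation.Unary.Unique.Propositional.Properties as UniqueProperties
open import Data.Nat
open import Data.Nat.Properties
open import Algebra.Properties.CommutativeMonoid.Sum +-0-commutativeMonoid
  using (sum; sum-cong-≗; ∑-distrib-+; sum-permute)
open import Data.Product using (∃; _×_; _,_; proj₁; proj₂)
open import Data.Sum using (inj₁)
open import Function using (_∘_; id)
open import Level using (Level; 0ℓ)
open import Relation.Binary.PropositionalEquality
open import Relation.Nullary using (¬_; Dec; yes; no; contradiction)
open import Relation.Unary using (Pred; Decidable; _⊆_; _∩_)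
open import Relation.Unary.Properties using (_∩?_; ∁?)

private
  variable
    a p q : Level
    A : Set a

indicator : Dec A → ℕ
indicator (yes _) = 1
indicator (no _)  = 0

count : ∀ {n} {P : Pred (Fin n) p} → Decidable P → ℕ
count P? = sum (indicator ∘ P?)

sum-mono-≤ : ∀ {n} {f g : Fin n → ℕ} → (∀ i → f i ≤ g i) → sum f ≤ sum g
sum-mono-≤ {zero}  _   = z≤n
sum-mono-≤ {suc n} f≤g = +-mono-≤ (f≤g zero) (sum-mono-≤ (f≤g ∘ suc))

sum-ones : ∀ n → sum {n} (λ _ → 1) ≡ n
sum-ones zero    = refl
sum-ones (suc n) = cong suc (sum-ones n)

count>0⇒∃ : ∀ {n} {P : Pred (Fin n) p} (P? : Decidable P) → 0 < count P? → ∃ P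
count>0⇒∃ {n = suc n} P? pos with P? zero
... | yes P0 = zero , P0
... | no _   = let i , Pi = count>0⇒∃ (P? ∘ suc) pos in suc i , Pi

length-filter-tabulate : ∀ {n} {P : Pred A p} (P? : Decidable P) (f : Fin n → A) →
                         length (filter P? (tabulate f)) ≡ count (P? ∘ f)
length-filter-tabulate {n = zero} P? f = refl
length-filter-tabulate {n = suc n} P? f with P? (f zero)
... | yes _ = cong suc (length-filter-tabulate P? (f ∘ suc))
... | no _  = length-filter-tabulate P? (f ∘ suc)

module _ {n : ℕ} where
  private
    variable
      P : Pred (Fin n) p
      Q : Pred (Fin n) q

  count-mono : (P? : Decidable P) (Q? : Decidable Q) → P ⊆ Q → count P? ≤ count Q?
  count-mono P? Q? P⊆Q = sum-mono-≤ pointwise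
    where
    pointwise : ∀ i → indicator (P? i) ≤ indicator (Q? i)
    pointwise i with P? i | Q? i
    ... | yes Pi | no ¬Qi = contradiction (P⊆Q Pi) ¬Qi
    ... | yes _  | yes _  = ≤-refl
    ... | no _   | _      = z≤n

  count-permute : (P? : Decidable P) (π : Permutation n n) → count (P? ∘ (π ⟨$⟩ʳ_)) ≡ count P?
  count-permute P? π = sym (sum-permute (indicator ∘ P?) π)

  count-complement : (P? : Decidable P) → count P? + count (∁? P?) ≡ n
  count-complement P? = begin
    count P? + count (∁? P?)
      ≡⟨ ∑-distrib-+ (indicator ∘ P?) (indicator ∘ ∁? P?) ⟨
    sum (λ i → indicator (P? i) + indicator (∁? P? i)) ≡⟨ sum-cong-≗ pointwise ⟩
    sum {n} (λ _ → 1)                                  ≡⟨ sum-ones n ⟩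
    n                                                  ∎
    where
    open ≡-Reasoning
    pointwise : ∀ i → indicator (P? i) + indicator (∁? P? i) ≡ 1
    pointwise i with P? i
    ... | yes _ = refl
    ... | no _  = refl

  count-∩ : (P? : Decidable P) (Q? : Decidable Q) → count P? + count Q? ≤ count (P? ∩? Q?) + n
  count-∩ P? Q? = begin
    count P? + count Q?
      ≡⟨ ∑-distrib-+ (indicator ∘ P?) (indicator ∘ Q?) ⟨
    sum (λ i → indicator (P? i) + indicator (Q? i))
      ≤⟨ sum-mono-≤ pointwise ⟩
    sum (λ i → indicator ((P? ∩? Q?) i) + 1)
      ≡⟨ ∑-distrib-+ (indicator ∘ (P? ∩? Q?)) (λ _ → 1) ⟩
    count (P? ∩? Q?) + sum {n} (λ _ → 1)
      ≡⟨ cong (count (P? ∩? Q?) +_) (sum-ones n) ⟩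
    count (P? ∩? Q?) + n
      ∎
    where
    open ≤-Reasoning
    pointwise : ∀ i → indicator (P? i) + indicator (Q? i) ≤ indicator ((P? ∩? Q?) i) + 1
    pointwise i with P? i | Q? i
    ... | yes _ | yes _ = ≤-refl
    ... | yes _ | no _  = ≤-refl
    ... | no _  | yes _ = ≤-refl
    ... | no _  | no _  = z≤n

  large-sets-meet : (P? : Decidable P) (Q? : Decidable Q) → n < count P? + count Q? → ∃ (P ∩ Q)
  large-sets-meet P? Q? large =
    count>0⇒∃ (P? ∩? Q?) (+-cancelʳ-< n 0 _ (<-≤-trans large (count-∩ P? Q?)))

3n<4s⇒n<2s : ∀ n s → 3 * n < 4 * s → n < 2 * s
3n<4s⇒n<2s n s 3n<4s = *-cancelˡ-< 2 n (2 * s) (begin-strict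
  2 * n         ≤⟨ *-monoˡ-≤ n (n≤1+n 2) ⟩
  3 * n         <⟨ 3n<4s ⟩
  4 * s         ≡⟨ *-assoc 2 2 s ⟩
  2 * (2 * s)   ∎)
  where open ≤-Reasoning

3n<4s⇒n<2b : ∀ n s b → 3 * n < 4 * s → 2 * s ≤ b + n → n < 2 * b
3n<4s⇒n<2b n s b 3n<4s 2s≤b+n = +-cancelʳ-< (2 * n) n (2 * b) (begin-strict
  n + 2 * n     ≡⟨⟩
  3 * n         <⟨ 3n<4s ⟩
  4 * s         ≡⟨ *-assoc 2 2 s ⟩
  2 * (2 * s)   ≤⟨ *-monoʳ-≤ 2 2s≤b+n ⟩
  2 * (b + n)   ≡⟨ *-distribˡ-+ 2 b n ⟩
  2 * b + 2 * n ∎)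
  where open ≤-Reasoning

4s≤3n⇒n≤4c : ∀ n s c → s + c ≡ n → 4 * s ≤ 3 * n → n ≤ 4 * c
4s≤3n⇒n≤4c n s c s+c≡n 4s≤3n = +-cancelˡ-≤ (4 * s) n (4 * c) (begin
  4 * s + n       ≤⟨ +-monoˡ-≤ n 4s≤3n ⟩
  3 * n + n       ≡⟨ +-comm (3 * n) n ⟩
  4 * n           ≡⟨ cong (4 *_) s+c≡n ⟨
  4 * (s + c)     ≡⟨ *-distribˡ-+ 4 s c ⟩
  4 * s + 4 * c   ∎)
  where open ≤-Reasoning

module _ (G : FiniteGroup) where
  open FiniteGroup G
  open IsGroup isGroup using (assoc; identityˡ; identityʳ; inverseʳ)

  private
    variable
      P : Pred (Fin order) p

  group : Group 0ℓ 0ℓ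
  group = record { isGroup = isGroup }

  open GroupProperties group
    using ( ∙-cancelˡ; ∙-cancelʳ; inverseʳ-unique; ⁻¹-anti-homo-∙; ⁻¹-involutive; ⁻¹-injective
          ; \\-leftDividesˡ; \\-leftDividesʳ)

  left-translation : Fin order → Permutation order order
  left-translation h = permutation (h ∙_) ((h ⁻¹) ∙_) (\\-leftDividesˡ h) (\\-leftDividesʳ h)

  inversion : Permutation order order
  inversion = permutation _⁻¹ _⁻¹ ⁻¹-involutive ⁻¹-involutive

  count-translate : (P? : Decidable P) (h : Fin order) → count (P? ∘ (h ∙_)) ≡ count P?
  count-translate P? h = count-permute P? (left-translation h)

  SquaresToε : Pred (Fin order) 0ℓ
  SquaresToε x = x ∙ x ≡ ε

  squaresToε? : Decidable SquaresToε
  squaresToε? x = (x ∙ x) Fin.≟ ε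

  Commutes : Fin order → Pred (Fin order) 0ℓ
  Commutes a x = a ∙ x ≡ x ∙ a

  commutes? : (a : Fin order) → Decidable (Commutes a)
  commutes? a x = (a ∙ x) Fin.≟ (x ∙ a)

  squaresToε⇒self-inverse : ∀ {x} → SquaresToε x → x ⁻¹ ≡ x
  squaresToε⇒self-inverse {x} x²≡ε = sym (inverseʳ-unique x x x²≡ε)

  squaresToε-commute : ∀ {x y} → SquaresToε x → SquaresToε y → SquaresToε (x ∙ y) → Commutes x y
  squaresToε-commute {x} {y} x²≡ε y²≡ε xy²≡ε = begin
    x ∙ y         ≡⟨ squaresToε⇒self-inverse xy²≡ε ⟨
    (x ∙ y) ⁻¹    ≡⟨ ⁻¹-anti-homo-∙ x y ⟩
    (y ⁻¹) ∙ (x ⁻¹) ≡⟨ cong₂ _∙_ (squaresToε⇒self-inverse y²≡ε) (squaresToε⇒self-inverse x²≡ε) ⟩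
    y ∙ x         ∎
    where open ≡-Reasoning

  commuting-product-squaresToε : ∀ {x y} → Commutes x y → SquaresToε x → SquaresToε y → SquaresToε (x ∙ y)
  commuting-product-squaresToε {x} {y} xy≡yx x²≡ε y²≡ε = begin
    (x ∙ y) ∙ (x ∙ y)   ≡⟨ assoc x y (x ∙ y) ⟩
    x ∙ (y ∙ (x ∙ y))   ≡⟨ cong (x ∙_) (assoc y x y) ⟨
    x ∙ ((y ∙ x) ∙ y)   ≡⟨ cong (λ t → x ∙ (t ∙ y)) xy≡yx ⟨
    x ∙ ((x ∙ y) ∙ y)   ≡⟨ cong (x ∙_) (assoc x y y) ⟩
    x ∙ (x ∙ (y ∙ y))   ≡⟨ cong (λ t → x ∙ (x ∙ t)) y²≡ε ⟩
    x ∙ (x ∙ ε)         ≡⟨ cong (x ∙_) (identityʳ x) ⟩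
    x ∙ x               ≡⟨ x²≡ε ⟩
    ε                   ∎
    where open ≡-Reasoning

  twice-count-translate : (P? : Decidable P) (h : Fin order) →
                          2 * count P? ≡ count P? + count (P? ∘ (h ∙_))
  twice-count-translate P? h =
    cong (count P? +_) (trans (+-identityʳ _) (sym (count-translate P? h)))

  large-meets-translate : (P? : Decidable P) (h : Fin order) →
                          order < 2 * count P? → ∃ λ x → P x × P (h ∙ x)
  large-meets-translate P? h large =
    large-sets-meet P? (P? ∘ (h ∙_)) (subst (order <_) (twice-count-translate P? h) large)

  -- The centralizer of a meets its translate by h: a commutes with some c and with h ∙ c.
  more-than-half-commute⇒central : ∀ a → order < 2 * count (commutes? a) → ∀ h → Commutes a h
  more-than-half-commute⇒central a large h = ∙-cancelʳ c (a ∙ h) (h ∙ a) (begin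
    (a ∙ h) ∙ c   ≡⟨ assoc a h c ⟩
    a ∙ (h ∙ c)   ≡⟨ ahc≡hca ⟩
    (h ∙ c) ∙ a   ≡⟨ assoc h c a ⟩
    h ∙ (c ∙ a)   ≡⟨ cong (h ∙_) ac≡ca ⟨
    h ∙ (a ∙ c)   ≡⟨ assoc h a c ⟨
    (h ∙ a) ∙ c   ∎)
    where
    open ≡-Reasoning
    meet = large-meets-translate (commutes? a) h large
    c = proj₁ meet
    ac≡ca = proj₁ (proj₂ meet)
    ahc≡hca = proj₂ (proj₂ meet)

  module _ (three-quarters : 3 * order < 4 * count squaresToε?) where

    squaresToε-central : ∀ {a} → SquaresToε a → ∀ h → Commutes a h
    squaresToε-central {a} a²≡ε = more-than-half-commute⇒central a
      (3n<4s⇒n<2b order s (count (commutes? a)) three-quarters (begin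
        2 * s                                   ≡⟨ twice-count-translate squaresToε? a ⟩
        s + count (squaresToε? ∘ (a ∙_))         ≤⟨ count-∩ squaresToε? (squaresToε? ∘ (a ∙_)) ⟩
        count (squaresToε? ∩? (squaresToε? ∘ (a ∙_))) + order
          ≤⟨ +-monoˡ-≤ order (count-mono (squaresToε? ∩? (squaresToε? ∘ (a ∙_))) (commutes? a)
                                          (λ (z²≡ε , az²≡ε) → squaresToε-commute a²≡ε z²≡ε az²≡ε)) ⟩
        count (commutes? a) + order              ∎))
      where
      open ≤-Reasoning
      s = count squaresToε?

    all-squaresToε : ∀ g → SquaresToε g
    all-squaresToε g = subst SquaresToε gy∙y≡g
      (commuting-product-squaresToε (squaresToε-central gy²≡ε y) gy²≡ε y²≡ε)
      where
      meet = large-meets-translate squaresToε? g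
               (3n<4s⇒n<2s order (count squaresToε?) three-quarters)
      y = proj₁ meet
      y²≡ε = proj₁ (proj₂ meet)
      gy²≡ε = proj₂ (proj₂ meet)
      gy∙y≡g : (g ∙ y) ∙ y ≡ g
      gy∙y≡g = trans (assoc g y y) (trans (cong (g ∙_) y²≡ε) (identityʳ g))

    three-quarters⇒elementaryAbelian2 : IsElementaryAbelian2 G
    three-quarters⇒elementaryAbelian2 =
      (λ x y → squaresToε-commute (all-squaresToε x) (all-squaresToε y) (all-squaresToε (x ∙ y))) ,
      all-squaresToε

  ¬elementaryAbelian2⇒order≤4*non-squaresToε : ¬ IsElementaryAbelian2 G →
                                              order ≤ 4 * count (∁? squaresToε?)
  ¬elementaryAbelian2⇒order≤4*non-squaresToε ¬EA with 3 * order <? 4 * count squaresToε?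
  ... | yes three-quarters = contradiction (three-quarters⇒elementaryAbelian2 three-quarters) ¬EA
  ... | no  ¬three-quarters = 4s≤3n⇒n≤4c order (count squaresToε?) (count (∁? squaresToε?))
                                 (count-complement squaresToε?) (≮⇒≥ ¬three-quarters)

  pow-+ : ∀ x i k → pow G x (i + k) ≡ pow G x i ∙ pow G x k
  pow-+ x zero    k = sym (identityˡ _)
  pow-+ x (suc i) k = trans (cong (x ∙_) (pow-+ x i k)) (sym (assoc _ _ _))

  repeated-power⇒inverse : ∀ x i o → pow G x i ≡ pow G x (i + suc o) → x ⁻¹ ≡ pow G x o
  repeated-power⇒inverse x i o xⁱ≡xⁱ⁺¹⁺ᵒ = sym (inverseʳ-unique x (pow G x o) (sym ε≡x∙xᵒ))
    where
    open ≡-Reasoning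
    ε≡x∙xᵒ : ε ≡ x ∙ pow G x o
    ε≡x∙xᵒ = ∙-cancelˡ (pow G x i) ε (pow G x (suc o)) (begin
      pow G x i ∙ ε                ≡⟨ identityʳ _ ⟩
      pow G x i                    ≡⟨ xⁱ≡xⁱ⁺¹⁺ᵒ ⟩
      pow G x (i + suc o)          ≡⟨ pow-+ x i (suc o) ⟩
      pow G x i ∙ pow G x (suc o)  ∎)

  -- By pigeonhole two of the powers x ^ 0, …, x ^ order coincide.
  inverse-isPowerOf : ∀ x → IsPowerOf G (x ⁻¹) x
  inverse-isPowerOf x with pigeonhole (n<1+n order) (λ k → pow G x (toℕ k))
  ... | i , j , i<j , xⁱ≡xʲ with m≤n⇒∃[o]m+o≡n i<j
  ... | o , 1+i+o≡j = o , repeated-power⇒inverse x (toℕ i) o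
        (trans xⁱ≡xʲ (cong (pow G x) (trans (sym 1+i+o≡j) (sym (+-suc (toℕ i) o)))))

  -- Selects one element, the one of smaller index, from each pair {x , x ⁻¹} with x ≢ x ⁻¹.
  BelowInverse : Pred (Fin order) 0ℓ
  BelowInverse x = toℕ x < toℕ (x ⁻¹)

  belowInverse? : Decidable BelowInverse
  belowInverse? x = toℕ x <? toℕ (x ⁻¹)

  belowInverse⇒≢⁻¹ : ∀ {x y} → BelowInverse x → BelowInverse y → x ≢ y ⁻¹
  belowInverse⇒≢⁻¹ {x} {y} x<x⁻¹ y<y⁻¹ x≡y⁻¹ = <-asym
    (subst (λ t → toℕ x < toℕ t) (trans (cong _⁻¹ x≡y⁻¹) (⁻¹-involutive y)) x<x⁻¹)
    (subst (λ t → toℕ y < toℕ t) (sym x≡y⁻¹) y<y⁻¹)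

  inverse-pairs : List (Fin order) → List (Fin order × Fin order)
  inverse-pairs = map (λ x → x , x ⁻¹)

  All-endpoints-inverse-pairs : ∀ {Q : Pred (Fin order) q} {xs} →
    All (λ y → Q y × Q (y ⁻¹)) xs → All Q (endpoints G (inverse-pairs xs))
  All-endpoints-inverse-pairs []                = []
  All-endpoints-inverse-pairs ((Qy , Qy⁻¹) ∷ Qs) = Qy ∷ Qy⁻¹ ∷ All-endpoints-inverse-pairs Qs

  inverse-pairs-isMatching : ∀ {xs} → Unique xs → All BelowInverse xs →
                             IsMatching G (inverse-pairs xs)
  inverse-pairs-isMatching []                      []           = [] , []
  inverse-pairs-isMatching {x ∷ _} (x∉xs ∷ unique) (x<x⁻¹ ∷ below) =
    ((x≢x⁻¹ , inj₁ (inverse-isPowerOf _)) ∷ proj₁ rest) ,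
    ((x≢x⁻¹ ∷ All-endpoints-inverse-pairs (All.zipWith x-fresh (x∉xs , below)))
      ∷ All-endpoints-inverse-pairs (All.zipWith x⁻¹-fresh (x∉xs , below))
      ∷ proj₂ rest)
    where
    rest = inverse-pairs-isMatching unique below
    x≢x⁻¹ = belowInverse⇒≢⁻¹ x<x⁻¹ x<x⁻¹
    x-fresh : ∀ {y} → x ≢ y × BelowInverse y → x ≢ y × x ≢ y ⁻¹
    x-fresh (x≢y , y<y⁻¹) = x≢y , belowInverse⇒≢⁻¹ x<x⁻¹ y<y⁻¹
    x⁻¹-fresh : ∀ {y} → x ≢ y × BelowInverse y → x ⁻¹ ≢ y × x ⁻¹ ≢ y ⁻¹
    x⁻¹-fresh (x≢y , y<y⁻¹) = belowInverse⇒≢⁻¹ y<y⁻¹ x<x⁻¹ ∘ sym , x≢y ∘ ⁻¹-injective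

  inverse-pair-matching : List (Fin order × Fin order)
  inverse-pair-matching = inverse-pairs (filter belowInverse? (allFin order))

  inverse-pair-matching-isMatching : IsMatching G inverse-pair-matching
  inverse-pair-matching-isMatching = inverse-pairs-isMatching
    (UniqueProperties.filter⁺ belowInverse? (UniqueProperties.allFin⁺ order))
    (all-filter belowInverse? (allFin order))

  length-inverse-pair-matching : length inverse-pair-matching ≡ count belowInverse?
  length-inverse-pair-matching = trans (length-map _ (filter belowInverse? (allFin order)))
    (length-filter-tabulate belowInverse? id)

  -- x ∙ x ≢ ε forces x ≢ x ⁻¹, so x or x ⁻¹ is below its inverse; inversion swaps the two counts.
  non-squaresToε≤2*belowInverse : count (∁? squaresToε?) ≤ 2 * count belowInverse?
  non-squaresToε≤2*belowInverse = begin
    count (∁? squaresToε?)                                           ≤⟨ sum-mono-≤ pointwise ⟩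
    sum (λ x → indicator (belowInverse? x) + indicator (belowInverse? (x ⁻¹)))
      ≡⟨ ∑-distrib-+ (indicator ∘ belowInverse?) (indicator ∘ belowInverse? ∘ _⁻¹) ⟩
    count belowInverse? + count (belowInverse? ∘ _⁻¹)
      ≡⟨ cong (count belowInverse? +_) (count-permute belowInverse? inversion) ⟩
    count belowInverse? + count belowInverse?
      ≡⟨ cong (count belowInverse? +_) (+-identityʳ _) ⟨
    2 * count belowInverse?                                          ∎
    where
    open ≤-Reasoning
    pointwise : ∀ x → indicator (∁? squaresToε? x) ≤
                      indicator (belowInverse? x) + indicator (belowInverse? (x ⁻¹))
    pointwise x with squaresToε? x | belowInverse? x | belowInverse? (x ⁻¹)
    ... | yes _   | _        | _        = z≤n
    ... | no _    | yes _    | _        = s≤s z≤n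
    ... | no _    | no _     | yes _    = s≤s z≤n
    ... | no x²≢ε | no x≮x⁻¹ | no x⁻¹≮x =
      contradiction (trans (cong (x ∙_) x≡x⁻¹) (inverseʳ x)) x²≢ε
      where
      x≡x⁻¹ : x ≡ x ⁻¹
      x≡x⁻¹ = toℕ-injective (≤-antisym
        (subst (λ t → toℕ t ≤ toℕ (x ⁻¹)) (⁻¹-involutive x) (≮⇒≥ x⁻¹≮x)) (≮⇒≥ x≮x⁻¹))

mainTheorem6 : (m : ℕ) → 1 ≤ m → (G : FiniteGroup) →
    ¬ IsElementaryAbelian2 G → MatchingNumberIs G m →
    FiniteGroup.order G < 8 * m + 4
mainTheorem6 m _ G ¬EA (_ , maximal) = begin-strict
  order                                ≤⟨ ¬elementaryAbelian2⇒order≤4*non-squaresToε G ¬EA ⟩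
  4 * count (∁? (squaresToε? G))       ≤⟨ *-monoʳ-≤ 4 (non-squaresToε≤2*belowInverse G) ⟩
  4 * (2 * count (belowInverse? G))    ≤⟨ *-monoʳ-≤ 4 (*-monoʳ-≤ 2 belowInverse≤m) ⟩
  4 * (2 * m)                          ≡⟨ *-assoc 4 2 m ⟨
  8 * m                                <⟨ m<m+n (8 * m) z<s ⟩
  8 * m + 4                            ∎
  where
  open FiniteGroup G using (order)
  open ≤-Reasoning
  belowInverse≤m : count (belowInverse? G) ≤ m
  belowInverse≤m = subst (_≤ m) (length-inverse-pair-matching G)
    (maximal (inverse-pair-matching G) (inverse-pair-matching-isMatching G))
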